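{- In $\mathsf{CaTT}$: for every derivable type $\Delta\vdash A$ we have $A[\rho_\Delta]=S(\Downarrow A)$; for every derivable term $\Delta\vdash t:A$ we have $t[\rho_\Delta]=S(\Downarrow t)$; and for every derivable substitution $\Delta\vdash\sigma:\Gamma$ we have $\sigma\circ\rho_\Delta=\rho_\Gamma\circ S(\Downarrow\sigma)$. (Here $\Downarrow$ of an expression is put in normal form before applying $S$.)
   Context: Substitution on variables: $x[\langle\rangle]=x$, $x[\langle\sigma,y\mapsto t\rangle]=t$ if $x=y$ else $x[\sigma]$; composition $\langle\rangle\circ\delta=\langle\rangle$, $\langle\sigma,x\mapsto t\rangle\circ\delta=\langle\sigma\circ\delta,x\mapsto t[\delta]\rangle$. $\mathsf{CaTT}$ is a dependent type theory (standard structural rules for contexts, variables, substitutions) with types $\star$, $\mathrm{Hom}_A\,t\,u$ and terms: variables, $\mathrm{op}_{\Theta,A}[\tau]$, $\mathrm{coh}_{\Theta,A}[\tau]$ ($\Theta$ a context, $A$ a type, $\tau$ a substitution); $\star[\sigma]=\star$, $(\mathrm{Hom}_Atu)[\sigma]=\mathrm{Hom}_{A[\sigma]}t[\sigma]u[\sigma]$, $\mathrm{op}_{\Theta,A}[\tau][\sigma]=\mathrm{op}_{\Theta,A}[\tau\circ\sigma]$ (same for coh); a derivable term $\Delta\vdash\mathrm{op}_{\Theta,A}[\tau]$ or $\mathrm{coh}_{\Theta,A}[\tau]$ requires $\Delta\vdash\tau:\Theta$. $\mathsf{MCaTT}$ raw syntax: types $\mathbf 1$, $\mathrm{Hom}_Atu$;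 terms: variables, $()$, $\mathrm{mop}_{\Theta,A}[\tau]$, $\mathrm{mcoh}_{\Theta,A}[\tau]$; in $\mathsf{MCaTT}$ every term of type $\mathbf 1$ is definitionally equal to $()$, and normal form rewrites each such term to $()$. Desuspension $\Downarrow$: $\Downarrow\varnothing=\varnothing$, $\Downarrow(\Gamma,x:A)=(\Downarrow\Gamma,x:\Downarrow A)$, $\Downarrow\star=\mathbf 1$, $\Downarrow\mathrm{Hom}_Atu=\mathrm{Hom}_{\Downarrow A}\Downarrow t\Downarrow u$, $\Downarrow x=x$, $\Downarrow\mathrm{op}_{\Theta,A}[\tau]=\mathrm{mop}_{\Theta,A}[\Downarrow\tau]$, $\Downarrow\mathrm{coh}_{\Theta,A}[\tau]=\mathrm{mcoh}_{\Theta,A}[\Downarrow\tau]$, $\Downarrow\langle\rangle=\langle\rangle$, $\Downarrow\langle\tau,x\mapsto t\rangle=\langle\Downarrow\tau,x\mapsto\Downarrow t\rangle$. Reduced suspension $S$ (from derivable $\mathsf{MCaTT}$ expressions in normal form to $\mathsf{CaTT}$ expressions). Fix a fresh variable $\bullet$: $S\varnothing=(\bullet:\star)$; $S(\Gamma,x:\mathbf 1)=S\Gamma$; $S(\Gamma,x:A)=(S\Gamma,x:SA)$ for $A\ne\mathbf 1$; $S\mathbf 1=\star$; $S\mathrm{Hom}_Atu=\mathrm{Hom}_{SA}St\,Su$; $S()=\bullet$; $Sx=x$ for a variable of type $\neq\mathbf 1$; $S\mathrm{mop}_{\Theta,A}[\tau]=\mathrm{op}_{\Theta,A}[\rho_\Theta\circ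 S\tau]$, $S\mathrm{mcoh}_{\Theta,A}[\tau]=\mathrm{coh}_{\Theta,A}[\rho_\Theta\circ S\tau]$; $S\langle\rangle=\langle\bullet\mapsto\bullet\rangle$; for $\Delta\vdash\langle\tau,x\mapsto t\rangle:(\Gamma,x:A)$, $S\langle\tau,x\mapsto t\rangle=S\tau$ if $A=\mathbf 1$ and $\langle S\tau,x\mapsto St\rangle$ otherwise. For a $\mathsf{CaTT}$ context $\Theta$: $\rho_\varnothing=\langle\rangle$, $\rho_{(\Theta,x:A)}=\langle\rho_\Theta,x\mapsto S(\Downarrow x)\rangle$ (this is $\bullet$ if $A=\star$ and $x$ otherwise). -}

module Defs where

open import Data.Nat using (ℕ)
import Data.Nat as ℕ
open import Data.Bool using (Bool; true; false; if_then_else_; _∨_)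
open import Data.Maybe using (Maybe; just; nothing)
open import Data.Product using (_×_)
open import Relation.Binary.PropositionalEquality using (_≡_; _≢_)
import Data.Empty

-- Variable names.  `bul` is the fixed fresh variable • used by the
-- reduced suspension; ordinary variables are `nm n`.

data Name : Set where
  bul : Name
  nm  : ℕ → Name

_==_ : Name → Name → Bool
bul  == bul  = true
bul  == nm _ = false
nm _ == bul  = false
nm m == nm n = m ℕ.≡ᵇ n

infixl 5 _,_∶_ _,_↦_

mutual
  data Ty : Set where
    ⋆   : Ty
    Hom : Ty → Tm → Tm → Ty

  data Tm : Set where
    v   : Name → Tm
    op  : Ctx → Ty → Sub → Tm
    coh : Ctx → Ty → Sub → Tm

  data Sub : Set where
    ⟨⟩    : Sub
    _,_↦_ : Sub → Name → Tm → Sub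

  data Ctx : Set where
    ∅     : Ctx
    _,_∶_ : Ctx → Name → Ty → Ctx

lookupSub : Name → Sub → Tm
lookupSub x ⟨⟩ = v x
lookupSub x (σ , y ↦ t) = if x == y then t else lookupSub x σ

mutual
  _[_]ty : Ty → Sub → Ty
  ⋆ [ σ ]ty = ⋆
  Hom A t u [ σ ]ty = Hom (A [ σ ]ty) (t [ σ ]tm) (u [ σ ]tm)

  _[_]tm : Tm → Sub → Tm
  v x [ σ ]tm = lookupSub x σ
  op Θ A τ [ σ ]tm = op Θ A (τ ∘ σ)
  coh Θ A τ [ σ ]tm = coh Θ A (τ ∘ σ)

  _∘_ : Sub → Sub → Sub
  ⟨⟩ ∘ δ = ⟨⟩
  (σ , x ↦ t) ∘ δ = (σ ∘ δ) , x ↦ (t [ δ ]tm)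

-- The side conditions of the op / coh rules (pasting-scheme condition,
-- source/target and free-variable conditions) are left abstract: the
-- theorem is stated for arbitrary side conditions.

record SideConditions : Set₁ where
  field
    OpCond  : Ctx → Ty → Tm → Tm → Set
    CohCond : Ctx → Ty → Tm → Tm → Set

data _∈dom_ : Name → Ctx → Set where
  here  : ∀ {Γ x y A} → (x == y) ≡ true → x ∈dom (Γ , y ∶ A)
  there : ∀ {Γ x y A} → x ∈dom Γ → x ∈dom (Γ , y ∶ A)

data _∶_∈_ : Name → Ty → Ctx → Set where
  here  : ∀ {Γ x A} → x ∶ A ∈ (Γ , x ∶ A)
  there : ∀ {Γ x y A B} → x ∶ A ∈ Γ → x ∶ A ∈ (Γ , y ∶ B)

module Rules (R : SideConditions) where
  open SideConditions R

  mutual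
    data _⊢ : Ctx → Set where
      ∅⊢   : ∅ ⊢
      ext⊢ : ∀ {Γ x A} → Γ ⊢ → Γ ⊢ A → ¬dom x Γ → (Γ , x ∶ A) ⊢

    data _⊢_ : Ctx → Ty → Set where
      ⋆⊢   : ∀ {Γ} → Γ ⊢ → Γ ⊢ ⋆
      Hom⊢ : ∀ {Γ A t u} → Γ ⊢ t ∶ A → Γ ⊢ u ∶ A → Γ ⊢ Hom A t u

    data _⊢_∶_ : Ctx → Tm → Ty → Set where
      var⊢ : ∀ {Γ x A} → Γ ⊢ → x ∶ A ∈ Γ → Γ ⊢ v x ∶ A
      op⊢  : ∀ {Δ Θ B t u τ} → OpCond Θ B t u → Θ ⊢ Hom B t u →
             Δ ⊢s τ ∶ Θ → Δ ⊢ op Θ (Hom B t u) τ ∶ (Hom B t u [ τ ]ty)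
      coh⊢ : ∀ {Δ Θ B t u τ} → CohCond Θ B t u → Θ ⊢ Hom B t u →
             Δ ⊢s τ ∶ Θ → Δ ⊢ coh Θ (Hom B t u) τ ∶ (Hom B t u [ τ ]ty)

    data _⊢s_∶_ : Ctx → Sub → Ctx → Set where
      ⟨⟩⊢  : ∀ {Δ} → Δ ⊢ → Δ ⊢s ⟨⟩ ∶ ∅
      ext⊢ : ∀ {Δ Γ σ x A t} → Δ ⊢s σ ∶ Γ → (Γ , x ∶ A) ⊢ →
             Δ ⊢ t ∶ (A [ σ ]ty) → Δ ⊢s (σ , x ↦ t) ∶ (Γ , x ∶ A)

    ¬dom : Name → Ctx → Set
    ¬dom x Γ = x ∈dom Γ → Data.Empty.⊥

mutual
  bulTy : Ty → Bool
  bulTy ⋆ = false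
  bulTy (Hom A t u) = bulTy A ∨ bulTm t ∨ bulTm u

  bulTm : Tm → Bool
  bulTm (v x) = x == bul
  bulTm (op Θ A τ) = bulCtx Θ ∨ bulTy A ∨ bulSub τ
  bulTm (coh Θ A τ) = bulCtx Θ ∨ bulTy A ∨ bulSub τ

  bulSub : Sub → Bool
  bulSub ⟨⟩ = false
  bulSub (σ , x ↦ t) = bulSub σ ∨ (x == bul) ∨ bulTm t

  bulCtx : Ctx → Bool
  bulCtx ∅ = false
  bulCtx (Γ , x ∶ A) = bulCtx Γ ∨ (x == bul) ∨ bulTy A

mutual
  data MTy : Set where
    𝟏    : MTy
    MHom : MTy → MTm → MTm → MTy

  data MTm : Set where
    mv    : Name → MTm
    unit  : MTm
    mop   : Ctx → Ty → MSub → MTm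
    mcoh  : Ctx → Ty → MSub → MTm

  data MSub : Set where
    ⟨⟩ₘ    : MSub
    _,_↦ₘ_ : MSub → Name → MTm → MSub

infixl 5 _,_∶ₘ_ _,_↦ₘ_

data MCtx : Set where
  ∅ₘ     : MCtx
  _,_∶ₘ_ : MCtx → Name → MTy → MCtx

mlookupSub : Name → MSub → MTm
mlookupSub x ⟨⟩ₘ = mv x
mlookupSub x (σ , y ↦ₘ t) = if x == y then t else mlookupSub x σ

mutual
  _[_]mty : MTy → MSub → MTy
  𝟏 [ σ ]mty = 𝟏
  MHom A t u [ σ ]mty = MHom (A [ σ ]mty) (t [ σ ]mtm) (u [ σ ]mtm)

  _[_]mtm : MTm → MSub → MTm
  mv x [ σ ]mtm = mlookupSub x σ
  unit [ σ ]mtm = unit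
  mop Θ A τ [ σ ]mtm = mop Θ A (τ ∘ₘ σ)
  mcoh Θ A τ [ σ ]mtm = mcoh Θ A (τ ∘ₘ σ)

  _∘ₘ_ : MSub → MSub → MSub
  ⟨⟩ₘ ∘ₘ δ = ⟨⟩ₘ
  (σ , x ↦ₘ t) ∘ₘ δ = (σ ∘ₘ δ) , x ↦ₘ (t [ δ ]mtm)

mlookupCtx : Name → MCtx → Maybe MTy
mlookupCtx x ∅ₘ = nothing
mlookupCtx x (Γ , y ∶ₘ A) = if x == y then just A else mlookupCtx x Γ

mutual
  ⇓ty : Ty → MTy
  ⇓ty ⋆ = 𝟏
  ⇓ty (Hom A t u) = MHom (⇓ty A) (⇓tm t) (⇓tm u)

  ⇓tm : Tm → MTm
  ⇓tm (v x) = mv x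
  ⇓tm (op Θ A τ) = mop Θ A (⇓sub τ)
  ⇓tm (coh Θ A τ) = mcoh Θ A (⇓sub τ)

  ⇓sub : Sub → MSub
  ⇓sub ⟨⟩ = ⟨⟩ₘ
  ⇓sub (τ , x ↦ t) = ⇓sub τ , x ↦ₘ ⇓tm t

⇓ctx : Ctx → MCtx
⇓ctx ∅ = ∅ₘ
⇓ctx (Γ , x ∶ A) = ⇓ctx Γ , x ∶ₘ ⇓ty A

isOne : Maybe MTy → Bool
isOne (just 𝟏) = true
isOne _ = false

mtypeOf : MCtx → MTm → Maybe MTy
mtypeOf Γ (mv x) = mlookupCtx x Γ
mtypeOf Γ unit = just 𝟏
mtypeOf Γ (mop Θ A τ) = just (⇓ty A [ τ ]mty)
mtypeOf Γ (mcoh Θ A τ) = just (⇓ty A [ τ ]mty)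

mutual
  nfTy : MCtx → MTy → MTy
  nfTy Γ 𝟏 = 𝟏
  nfTy Γ (MHom A t u) = MHom (nfTy Γ A) (nfTm Γ t) (nfTm Γ u)

  nfTm : MCtx → MTm → MTm
  nfTm Γ (mv x) = if isOne (mtypeOf Γ (mv x)) then unit else mv x
  nfTm Γ unit = unit
  nfTm Γ (mop Θ A τ) =
    if isOne (mtypeOf Γ (mop Θ A τ)) then unit else mop Θ A (nfSub Γ τ)
  nfTm Γ (mcoh Θ A τ) =
    if isOne (mtypeOf Γ (mcoh Θ A τ)) then unit else mcoh Θ A (nfSub Γ τ)

  nfSub : MCtx → MSub → MSub
  nfSub Γ ⟨⟩ₘ = ⟨⟩ₘ
  nfSub Γ (τ , x ↦ₘ t) = nfSub Γ τ , x ↦ₘ nfTm Γ t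

-- ρ_Θ = ⟨ρ_Θ', x ↦ S(⇓x)⟩, i.e. • if the type of x is ⋆ and x otherwise.

ρ : Ctx → Sub
ρ ∅ = ⟨⟩
ρ (Θ , x ∶ ⋆) = ρ Θ , x ↦ v bul
ρ (Θ , x ∶ Hom A t u) = ρ Θ , x ↦ v x

-- Reduced suspension S (MCaTT normal forms → CaTT).
-- S on substitutions needs the target context, to know which entries
-- are of type 𝟏 (these are dropped).

mutual
  STy : MTy → Ty
  STy 𝟏 = ⋆
  STy (MHom A t u) = Hom (STy A) (STm t) (STm u)

  STm : MTm → Tm
  STm (mv x) = v x
  STm unit = v bul
  STm (mop Θ A τ) = op Θ A (ρ Θ ∘ SSub (⇓ctx Θ) τ)
  STm (mcoh Θ A τ) = coh Θ A (ρ Θ ∘ SSub (⇓ctx Θ) τ)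

  SSub : MCtx → MSub → Sub
  SSub Γ ⟨⟩ₘ = ⟨⟩ , bul ↦ v bul
  SSub Γ (τ , x ↦ₘ t) =
    if isOne (mlookupCtx x Γ) then SSub Γ τ else (SSub Γ τ , x ↦ STm t)

SCtx : MCtx → Ctx
SCtx ∅ₘ = ∅ , bul ∶ ⋆
SCtx (Γ , x ∶ₘ 𝟏) = SCtx Γ
SCtx (Γ , x ∶ₘ MHom A t u) = SCtx Γ , x ∶ STy (MHom A t u)

{-# OPTIONS --safe #-}
-- On a variable, ρ_Δ and S ∘ nf ∘ ⇓ agree by construction: both
-- send variables of type ⋆ to • and fix the others.  On op/coh the claim is
-- the one for the argument substitution.  For substitutions, an entry of type
-- ⋆ is dropped by S and restored as • by ρ_Γ; this uses that a term of type ⋆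
-- is a variable, so ρ_Δ sends it to •.  The only non-syntactic input is that
-- the type of a derivable term is derivable (the substitution lemma), needed
-- because the induction for Hom_A t u recurses into A.
module Submission where

open import Defs
open import Data.Bool using (true; false; _∨_; if_then_else_)
open import Data.Bool.Properties using (T-≡; not-¬)
open import Data.Nat.Properties using (≡ᵇ⇒≡; ≡⇒≡ᵇ)
open import Data.Product using (_×_; _,_)
open import Data.Empty using (⊥-elim)
open import Function.Bundles using (Equivalence)
open import Relation.Nullary using (¬_)
open import Relation.Binary.PropositionalEquality
open ≡-Reasoning

∨≡false⇒ˡ : ∀ a {b} → a ∨ b ≡ false → a ≡ false
∨≡false⇒ˡ false _ = refl
∨≡false⇒ˡ true ()

∨≡false⇒ʳ : ∀ a {b} → a ∨ b ≡ false → b ≡ false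
∨≡false⇒ʳ false b≡false = b≡false
∨≡false⇒ʳ true ()

==-refl : ∀ x → (x == x) ≡ true
==-refl bul    = refl
==-refl (nm n) = Equivalence.to T-≡ (≡⇒≡ᵇ n n refl)

==⇒≡ : ∀ x y → (x == y) ≡ true → x ≡ y
==⇒≡ bul    bul    _   = refl
==⇒≡ bul    (nm _) ()
==⇒≡ (nm _) bul    ()
==⇒≡ (nm m) (nm n) m≡n = cong nm (≡ᵇ⇒≡ m n (Equivalence.from T-≡ m≡n))

•==-comm : ∀ x → (bul == x) ≡ (x == bul)
•==-comm bul    = refl
•==-comm (nm _) = refl

∈⇒∈dom : ∀ {x A Γ} → x ∶ A ∈ Γ → x ∈dom Γ
∈⇒∈dom {x} here   = here (==-refl x)
∈⇒∈dom (there m) = there (∈⇒∈dom m)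

∈dom-tail : ∀ {x y A Γ} → x ∈dom (Γ , y ∶ A) → (x == y) ≡ false → x ∈dom Γ
∈dom-tail (here x==y) x≢y = ⊥-elim (not-¬ x==y x≢y)
∈dom-tail (there x∈)  _   = x∈

∈dom∧∉dom⇒==false : ∀ {x y Γ} → x ∈dom Γ → ¬ y ∈dom Γ → (x == y) ≡ false
∈dom∧∉dom⇒==false {x} {y} x∈ y∉ with x == y in x==y
... | true  = ⊥-elim (y∉ (subst (_∈dom _) (==⇒≡ x y x==y) x∈))
... | false = refl

lookup-here : ∀ x σ t → lookupSub x (σ , x ↦ t) ≡ t
lookup-here x σ t rewrite ==-refl x = refl

lookup-there : ∀ {x y} σ t → (x == y) ≡ false → lookupSub x (σ , y ↦ t) ≡ lookupSub x σ
lookup-there σ t x≢y rewrite x≢y = refl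

cong-Hom : ∀ {A A′ t t′ u u′} → A ≡ A′ → t ≡ t′ → u ≡ u′ → Hom A t u ≡ Hom A′ t′ u′
cong-Hom refl refl refl = refl

mutual
  data ScopedTy (Γ : Ctx) : Ty → Set where
    ⋆ˢ   : ScopedTy Γ ⋆
    Homˢ : ∀ {A t u} → ScopedTy Γ A → ScopedTm Γ t → ScopedTm Γ u → ScopedTy Γ (Hom A t u)

  data ScopedTm (Γ : Ctx) : Tm → Set where
    vˢ   : ∀ {x} → x ∈dom Γ → ScopedTm Γ (v x)
    opˢ  : ∀ {Θ A τ} → ScopedSub Γ τ → ScopedTm Γ (op Θ A τ)
    cohˢ : ∀ {Θ A τ} → ScopedSub Γ τ → ScopedTm Γ (coh Θ A τ)

  data ScopedSub (Γ : Ctx) : Sub → Set where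
    ⟨⟩ˢ  : ScopedSub Γ ⟨⟩
    extˢ : ∀ {σ x t} → ScopedSub Γ σ → ScopedTm Γ t → ScopedSub Γ (σ , x ↦ t)

mutual
  ty-ext-fresh : ∀ {Γ A y} → ScopedTy Γ A → ¬ y ∈dom Γ → ∀ σ t → A [ σ , y ↦ t ]ty ≡ A [ σ ]ty
  ty-ext-fresh ⋆ˢ           _  _ _ = refl
  ty-ext-fresh (Homˢ A t u) y∉ σ s =
    cong-Hom (ty-ext-fresh A y∉ σ s) (tm-ext-fresh t y∉ σ s) (tm-ext-fresh u y∉ σ s)

  tm-ext-fresh : ∀ {Γ t y} → ScopedTm Γ t → ¬ y ∈dom Γ → ∀ σ s → t [ σ , y ↦ s ]tm ≡ t [ σ ]tm
  tm-ext-fresh (vˢ x∈)  y∉ σ s = lookup-there σ s (∈dom∧∉dom⇒==false x∈ y∉)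
  tm-ext-fresh (opˢ τ)  y∉ σ s = cong (op _ _) (∘-ext-fresh τ y∉ σ s)
  tm-ext-fresh (cohˢ τ) y∉ σ s = cong (coh _ _) (∘-ext-fresh τ y∉ σ s)

  ∘-ext-fresh : ∀ {Γ τ y} → ScopedSub Γ τ → ¬ y ∈dom Γ → ∀ σ s → τ ∘ (σ , y ↦ s) ≡ τ ∘ σ
  ∘-ext-fresh ⟨⟩ˢ        _  _ _ = refl
  ∘-ext-fresh (extˢ τ t) y∉ σ s = cong₂ (_, _ ↦_) (∘-ext-fresh τ y∉ σ s) (tm-ext-fresh t y∉ σ s)

_⊆dom_ : Ctx → Ctx → Set
Γ ⊆dom Δ = ∀ {x} → x ∈dom Γ → x ∈dom Δ

⊆dom-skip : ∀ {Γ x A y B} → (Γ , y ∶ B) ⊆dom (Γ , x ∶ A , y ∶ B)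
⊆dom-skip (here y==) = here y==
⊆dom-skip (there x∈) = there (there x∈)

mutual
  scopedTy-mono : ∀ {Γ Δ A} → Γ ⊆dom Δ → ScopedTy Γ A → ScopedTy Δ A
  scopedTy-mono Γ⊆Δ ⋆ˢ           = ⋆ˢ
  scopedTy-mono Γ⊆Δ (Homˢ A t u) = Homˢ (scopedTy-mono Γ⊆Δ A) (scopedTm-mono Γ⊆Δ t) (scopedTm-mono Γ⊆Δ u)

  scopedTm-mono : ∀ {Γ Δ t} → Γ ⊆dom Δ → ScopedTm Γ t → ScopedTm Δ t
  scopedTm-mono Γ⊆Δ (vˢ x∈)  = vˢ (Γ⊆Δ x∈)
  scopedTm-mono Γ⊆Δ (opˢ τ)  = opˢ (scopedSub-mono Γ⊆Δ τ)
  scopedTm-mono Γ⊆Δ (cohˢ τ) = cohˢ (scopedSub-mono Γ⊆Δ τ)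

  scopedSub-mono : ∀ {Γ Δ σ} → Γ ⊆dom Δ → ScopedSub Γ σ → ScopedSub Δ σ
  scopedSub-mono Γ⊆Δ ⟨⟩ˢ        = ⟨⟩ˢ
  scopedSub-mono Γ⊆Δ (extˢ σ t) = extˢ (scopedSub-mono Γ⊆Δ σ) (scopedTm-mono Γ⊆Δ t)

ScopedSubst : Ctx → Sub → Ctx → Set
ScopedSubst Δ σ Θ = ∀ {x} → x ∈dom Θ → ScopedTm Δ (lookupSub x σ)

mutual
  scopedTy-[] : ∀ {Θ Δ A σ} → ScopedTy Θ A → ScopedSubst Δ σ Θ → ScopedTy Δ (A [ σ ]ty)
  scopedTy-[] ⋆ˢ           σ = ⋆ˢ
  scopedTy-[] (Homˢ A t u) σ = Homˢ (scopedTy-[] A σ) (scopedTm-[] t σ) (scopedTm-[] u σ)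

  scopedTm-[] : ∀ {Θ Δ t σ} → ScopedTm Θ t → ScopedSubst Δ σ Θ → ScopedTm Δ (t [ σ ]tm)
  scopedTm-[] (vˢ x∈)  σ = σ x∈
  scopedTm-[] (opˢ τ)  σ = opˢ (scopedSub-∘ τ σ)
  scopedTm-[] (cohˢ τ) σ = cohˢ (scopedSub-∘ τ σ)

  scopedSub-∘ : ∀ {Θ Δ τ σ} → ScopedSub Θ τ → ScopedSubst Δ σ Θ → ScopedSub Δ (τ ∘ σ)
  scopedSub-∘ ⟨⟩ˢ        σ = ⟨⟩ˢ
  scopedSub-∘ (extˢ τ t) σ = extˢ (scopedSub-∘ τ σ) (scopedTm-[] t σ)

ρ-scoped : ∀ Γ → ScopedSub (Γ , bul ∶ ⋆) (ρ Γ)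
ρ-scoped ∅           = ⟨⟩ˢ
ρ-scoped (Γ , x ∶ ⋆) = extˢ (scopedSub-mono ⊆dom-skip (ρ-scoped Γ)) (vˢ (here refl))
ρ-scoped (Γ , x ∶ Hom A t u) =
  extˢ (scopedSub-mono ⊆dom-skip (ρ-scoped Γ)) (vˢ (there (here (==-refl x))))

ρ∘-ext-fresh : ∀ {x} Γ → ¬ x ∈dom Γ → (x == bul) ≡ false → ∀ σ t → ρ Γ ∘ (σ , x ↦ t) ≡ ρ Γ ∘ σ
ρ∘-ext-fresh {x} Γ x∉Γ x≢• = ∘-ext-fresh (ρ-scoped Γ) x∉Γ•
  where
    x∉Γ• : ¬ x ∈dom (Γ , bul ∶ ⋆)
    x∉Γ• (here x==•) = not-¬ x==• x≢•
    x∉Γ• (there x∈)  = x∉Γ x∈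

lookup-ρ : ∀ Δ x → lookupSub x (ρ Δ) ≡ STm (if isOne (mlookupCtx x (⇓ctx Δ)) then unit else mv x)
lookup-ρ ∅ x = refl
lookup-ρ (Δ , y ∶ ⋆) x with x == y
... | true  = refl
... | false = lookup-ρ Δ x
lookup-ρ (Δ , y ∶ Hom A t u) x with x == y in x==y
... | true  = cong v (sym (==⇒≡ x y x==y))
... | false = lookup-ρ Δ x

lookup-ρ-there : ∀ {x y} Δ B → (x == y) ≡ false → lookupSub x (ρ (Δ , y ∶ B)) ≡ lookupSub x (ρ Δ)
lookup-ρ-there Δ ⋆           x≢y = lookup-there (ρ Δ) (v bul) x≢y
lookup-ρ-there Δ (Hom A t u) x≢y = lookup-there (ρ Δ) (v _) x≢y

•∉dom : ∀ Γ → bulCtx Γ ≡ false → ¬ bul ∈dom Γ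
•∉dom (Γ , y ∶ A) •∉Γy (here •==y) =
  not-¬ •==y (trans (•==-comm y) (∨≡false⇒ˡ _ (∨≡false⇒ʳ (bulCtx Γ) •∉Γy)))
•∉dom (Γ , y ∶ A) •∉Γy (there •∈) = •∉dom Γ (∨≡false⇒ˡ _ •∉Γy) •∈

data _∉domₘ_ (x : Name) : MSub → Set where
  ⟨⟩ₘ  : x ∉domₘ ⟨⟩ₘ
  extₘ : ∀ {τ y t} → (y == x) ≡ false → x ∉domₘ τ → x ∉domₘ (τ , y ↦ₘ t)

SSub-fresh-ext : ∀ {x} Γ B τ → x ∉domₘ τ → SSub (Γ , x ∶ₘ B) τ ≡ SSub Γ τ
SSub-fresh-ext Γ B ⟨⟩ₘ          ⟨⟩ₘ            = refl
SSub-fresh-ext Γ B (τ , y ↦ₘ s) (extₘ y≢x x∉τ) rewrite y≢x | SSub-fresh-ext Γ B τ x∉τ = refl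

SSub-𝟏-entry : ∀ {x} Γ τ t → x ∉domₘ τ → SSub (Γ , x ∶ₘ 𝟏) (τ , x ↦ₘ t) ≡ SSub Γ τ
SSub-𝟏-entry {x} Γ τ t x∉τ rewrite ==-refl x = SSub-fresh-ext Γ 𝟏 τ x∉τ

SSub-Hom-entry : ∀ {x} Γ A a b τ t → x ∉domₘ τ →
  SSub (Γ , x ∶ₘ MHom A a b) (τ , x ↦ₘ t) ≡ (SSub Γ τ , x ↦ STm t)
SSub-Hom-entry {x} Γ A a b τ t x∉τ
  rewrite ==-refl x = cong (_, x ↦ STm t) (SSub-fresh-ext Γ (MHom A a b) τ x∉τ)

lookup-•-SSub : ∀ Γ τ → bul ∉domₘ τ → lookupSub bul (SSub Γ τ) ≡ v bul
lookup-•-SSub Γ ⟨⟩ₘ          ⟨⟩ₘ = refl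
lookup-•-SSub Γ (τ , y ↦ₘ s) (extₘ y≢• •∉τ) with isOne (mlookupCtx y Γ)
... | true  = lookup-•-SSub Γ τ •∉τ
... | false = trans (lookup-there {bul} {y} (SSub Γ τ) (STm s) (trans (•==-comm y) y≢•))
                    (lookup-•-SSub Γ τ •∉τ)

_⊆_ : Ctx → Ctx → Set
Γ ⊆ Δ = ∀ {x A} → x ∶ A ∈ Γ → x ∶ A ∈ Δ

module _ (R : SideConditions) where
  open Rules R

  mutual
    weaken-ty : ∀ {Γ Δ A} → Δ ⊢ → Γ ⊆ Δ → Γ ⊢ A → Δ ⊢ A
    weaken-ty ⊢Δ Γ⊆Δ (⋆⊢ _)     = ⋆⊢ ⊢Δ
    weaken-ty ⊢Δ Γ⊆Δ (Hom⊢ t u) = Hom⊢ (weaken-tm ⊢Δ Γ⊆Δ t) (weaken-tm ⊢Δ Γ⊆Δ u)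

    weaken-tm : ∀ {Γ Δ t A} → Δ ⊢ → Γ ⊆ Δ → Γ ⊢ t ∶ A → Δ ⊢ t ∶ A
    weaken-tm ⊢Δ Γ⊆Δ (var⊢ _ x∈)  = var⊢ ⊢Δ (Γ⊆Δ x∈)
    weaken-tm ⊢Δ Γ⊆Δ (op⊢ c h τ)  = op⊢ c h (weaken-sub ⊢Δ Γ⊆Δ τ)
    weaken-tm ⊢Δ Γ⊆Δ (coh⊢ c h τ) = coh⊢ c h (weaken-sub ⊢Δ Γ⊆Δ τ)

    weaken-sub : ∀ {Γ Δ σ Θ} → Δ ⊢ → Γ ⊆ Δ → Γ ⊢s σ ∶ Θ → Δ ⊢s σ ∶ Θ
    weaken-sub ⊢Δ Γ⊆Δ (⟨⟩⊢ _)      = ⟨⟩⊢ ⊢Δ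
    weaken-sub ⊢Δ Γ⊆Δ (ext⊢ σ c t) = ext⊢ (weaken-sub ⊢Δ Γ⊆Δ σ) c (weaken-tm ⊢Δ Γ⊆Δ t)

  ∈⇒⊢ : ∀ {Γ x A} → Γ ⊢ → x ∶ A ∈ Γ → Γ ⊢ A
  ∈⇒⊢ ⊢Γx@(ext⊢ _  ⊢A _) here      = weaken-ty ⊢Γx there ⊢A
  ∈⇒⊢ ⊢Γx@(ext⊢ ⊢Γ _  _) (there m) = weaken-ty ⊢Γx there (∈⇒⊢ ⊢Γ m)

  ⊢s⇒⊢ : ∀ {Δ σ Θ} → Δ ⊢s σ ∶ Θ → Δ ⊢
  ⊢s⇒⊢ (⟨⟩⊢ ⊢Δ)     = ⊢Δ
  ⊢s⇒⊢ (ext⊢ σ _ _) = ⊢s⇒⊢ σ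

  mutual
    ⊢tm⇒scoped : ∀ {Γ t A} → Γ ⊢ t ∶ A → ScopedTm Γ t
    ⊢tm⇒scoped (var⊢ _ x∈)  = vˢ (∈⇒∈dom x∈)
    ⊢tm⇒scoped (op⊢ _ _ τ)  = opˢ (⊢s⇒scoped τ)
    ⊢tm⇒scoped (coh⊢ _ _ τ) = cohˢ (⊢s⇒scoped τ)

    ⊢s⇒scoped : ∀ {Δ σ Θ} → Δ ⊢s σ ∶ Θ → ScopedSub Δ σ
    ⊢s⇒scoped (⟨⟩⊢ _)      = ⟨⟩ˢ
    ⊢s⇒scoped (ext⊢ σ _ t) = extˢ (⊢s⇒scoped σ) (⊢tm⇒scoped t)

  ⊢s⇒ScopedSubst : ∀ {Δ σ Θ} → Δ ⊢s σ ∶ Θ → ScopedSubst Δ σ Θ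
  ⊢s⇒ScopedSubst (ext⊢ {x = y} σ _ t) {x} x∈ with x == y in x==y
  ... | true  = ⊢tm⇒scoped t
  ... | false = ⊢s⇒ScopedSubst σ (∈dom-tail x∈ x==y)

  mutual
    ⊢ty⇒scoped : ∀ {Γ A} → Γ ⊢ A → ScopedTy Γ A
    ⊢ty⇒scoped (⋆⊢ _)     = ⋆ˢ
    ⊢ty⇒scoped (Hom⊢ t u) = Homˢ (type-scoped t) (⊢tm⇒scoped t) (⊢tm⇒scoped u)

    type-scoped : ∀ {Γ t A} → Γ ⊢ t ∶ A → ScopedTy Γ A
    type-scoped (var⊢ ⊢Γ x∈) = ∈⇒scoped ⊢Γ x∈
    type-scoped (op⊢ _ h τ)  = scopedTy-[] (⊢ty⇒scoped h) (⊢s⇒ScopedSubst τ)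
    type-scoped (coh⊢ _ h τ) = scopedTy-[] (⊢ty⇒scoped h) (⊢s⇒ScopedSubst τ)

    ∈⇒scoped : ∀ {Γ x A} → Γ ⊢ → x ∶ A ∈ Γ → ScopedTy Γ A
    ∈⇒scoped (ext⊢ _  ⊢A _) here      = scopedTy-mono there (⊢ty⇒scoped ⊢A)
    ∈⇒scoped (ext⊢ ⊢Γ _  _) (there m) = scopedTy-mono there (∈⇒scoped ⊢Γ m)

  lookup-∘ : ∀ {Δ σ Θ x} → Δ ⊢s σ ∶ Θ → x ∈dom Θ → ∀ δ →
    (lookupSub x σ) [ δ ]tm ≡ lookupSub x (σ ∘ δ)
  lookup-∘ {x = x} (ext⊢ {x = y} σ _ _) x∈ δ with x == y in x==y
  ... | true  = refl
  ... | false = lookup-∘ σ (∈dom-tail x∈ x==y) δ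

  mutual
    []ty-∘ : ∀ {Θ Δ A σ} → ScopedTy Θ A → Δ ⊢s σ ∶ Θ → ∀ δ → (A [ σ ]ty) [ δ ]ty ≡ A [ σ ∘ δ ]ty
    []ty-∘ ⋆ˢ           σ δ = refl
    []ty-∘ (Homˢ A t u) σ δ = cong-Hom ([]ty-∘ A σ δ) ([]tm-∘ t σ δ) ([]tm-∘ u σ δ)

    []tm-∘ : ∀ {Θ Δ t σ} → ScopedTm Θ t → Δ ⊢s σ ∶ Θ → ∀ δ → (t [ σ ]tm) [ δ ]tm ≡ t [ σ ∘ δ ]tm
    []tm-∘ (vˢ x∈)  σ δ = lookup-∘ σ x∈ δ
    []tm-∘ (opˢ τ)  σ δ = cong (op _ _) (∘-assoc τ σ δ)
    []tm-∘ (cohˢ τ) σ δ = cong (coh _ _) (∘-assoc τ σ δ)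

    ∘-assoc : ∀ {Θ Δ τ σ} → ScopedSub Θ τ → Δ ⊢s σ ∶ Θ → ∀ δ → (τ ∘ σ) ∘ δ ≡ τ ∘ (σ ∘ δ)
    ∘-assoc ⟨⟩ˢ        σ δ = refl
    ∘-assoc (extˢ τ t) σ δ = cong₂ (_, _ ↦_) (∘-assoc τ σ δ) ([]tm-∘ t σ δ)

  lookup-⊢ : ∀ {Θ Δ τ x A} → x ∶ A ∈ Θ → Δ ⊢s τ ∶ Θ → Δ ⊢ lookupSub x τ ∶ (A [ τ ]ty)
  lookup-⊢ here (ext⊢ {σ = τ} {x = y} {t = t} _ (ext⊢ _ ⊢A y∉) ⊢t)
    rewrite lookup-here y τ t | ty-ext-fresh (⊢ty⇒scoped ⊢A) y∉ τ t = ⊢t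
  lookup-⊢ (there x∈) (ext⊢ {σ = τ} {t = t} τ⊢ (ext⊢ ⊢Θ _ y∉) _)
    rewrite ∈dom∧∉dom⇒==false (∈⇒∈dom x∈) y∉
          | ty-ext-fresh (∈⇒scoped ⊢Θ x∈) y∉ τ t = lookup-⊢ x∈ τ⊢

  mutual
    []ty-⊢ : ∀ {Θ Δ A τ} → Θ ⊢ A → Δ ⊢s τ ∶ Θ → Δ ⊢ (A [ τ ]ty)
    []ty-⊢ (⋆⊢ _)     τ = ⋆⊢ (⊢s⇒⊢ τ)
    []ty-⊢ (Hom⊢ t u) τ = Hom⊢ ([]tm-⊢ t τ) ([]tm-⊢ u τ)

    []tm-⊢ : ∀ {Θ Δ t A τ} → Θ ⊢ t ∶ A → Δ ⊢s τ ∶ Θ → Δ ⊢ (t [ τ ]tm) ∶ (A [ τ ]ty)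
    []tm-⊢ (var⊢ _ x∈) τ = lookup-⊢ x∈ τ
    []tm-⊢ {Δ = Δ} {τ = τ} (op⊢ {Θ = Θ} {B} {t} {u} {σ} c h σ⊢) τ⊢ =
      subst (Δ ⊢ op Θ (Hom B t u) (σ ∘ τ) ∶_) (sym ([]ty-∘ (⊢ty⇒scoped h) σ⊢ τ)) (op⊢ c h (∘-⊢s σ⊢ τ⊢))
    []tm-⊢ {Δ = Δ} {τ = τ} (coh⊢ {Θ = Θ} {B} {t} {u} {σ} c h σ⊢) τ⊢ =
      subst (Δ ⊢ coh Θ (Hom B t u) (σ ∘ τ) ∶_) (sym ([]ty-∘ (⊢ty⇒scoped h) σ⊢ τ)) (coh⊢ c h (∘-⊢s σ⊢ τ⊢))

    ∘-⊢s : ∀ {Θ Δ σ Γ τ} → Θ ⊢s σ ∶ Γ → Δ ⊢s τ ∶ Θ → Δ ⊢s (σ ∘ τ) ∶ Γ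
    ∘-⊢s (⟨⟩⊢ _) τ⊢ = ⟨⟩⊢ (⊢s⇒⊢ τ⊢)
    ∘-⊢s {Δ = Δ} {τ = τ} (ext⊢ {t = t} σ⊢ ⊢Γx@(ext⊢ _ ⊢A _) ⊢t) τ⊢ =
      ext⊢ (∘-⊢s σ⊢ τ⊢) ⊢Γx (subst (Δ ⊢ t [ τ ]tm ∶_) ([]ty-∘ (⊢ty⇒scoped ⊢A) σ⊢ τ) ([]tm-⊢ ⊢t τ⊢))

  type-⊢ : ∀ {Δ t A} → Δ ⊢ t ∶ A → Δ ⊢ A
  type-⊢ (var⊢ ⊢Δ x∈) = ∈⇒⊢ ⊢Δ x∈
  type-⊢ (op⊢ _ h τ)  = []ty-⊢ h τ
  type-⊢ (coh⊢ _ h τ) = []ty-⊢ h τ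

  ∉dom⇒∉domₘ-nf⇓ : ∀ {Δ σ Γ x} → Δ ⊢s σ ∶ Γ → ¬ x ∈dom Γ → ∀ Ξ → x ∉domₘ nfSub Ξ (⇓sub σ)
  ∉dom⇒∉domₘ-nf⇓ (⟨⟩⊢ _)              _  _ = ⟨⟩ₘ
  ∉dom⇒∉domₘ-nf⇓ (ext⊢ {x = y} σ _ _) x∉ Ξ =
    extₘ (∈dom∧∉dom⇒==false {y} (here (==-refl y)) x∉) (∉dom⇒∉domₘ-nf⇓ σ (λ x∈ → x∉ (there x∈)) Ξ)

  lookup-ρ-⋆ : ∀ {Δ x} → Δ ⊢ → x ∶ ⋆ ∈ Δ → lookupSub x (ρ Δ) ≡ v bul
  lookup-ρ-⋆ {x = x} (ext⊢ {Γ = Δ} _ _ _) here = lookup-here x (ρ Δ) (v bul)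
  lookup-ρ-⋆ (ext⊢ {Γ = Δ} {A = B} ⊢Δ _ y∉) (there x∈) =
    trans (lookup-ρ-there Δ B (∈dom∧∉dom⇒==false (∈⇒∈dom x∈) y∉)) (lookup-ρ-⋆ ⊢Δ x∈)

  -- op and coh have arrow types, so only variables have type ⋆.
  [ρ]-⋆ : ∀ {Δ t} → Δ ⊢ t ∶ ⋆ → t [ ρ Δ ]tm ≡ v bul
  [ρ]-⋆ (var⊢ ⊢Δ x∈) = lookup-ρ-⋆ ⊢Δ x∈

  mutual
    [ρ]tm≡S⇓ : ∀ {Δ t A} → Δ ⊢ t ∶ A → bulTm t ≡ false →
      t [ ρ Δ ]tm ≡ STm (nfTm (⇓ctx Δ) (⇓tm t))
    [ρ]tm≡S⇓ {Δ} (var⊢ {x = x} _ _) _ = lookup-ρ Δ x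
    [ρ]tm≡S⇓ (op⊢ {Θ = Θ} _ _ τ) •∉t =
      cong (op Θ _) (∘ρ≡ρ∘S⇓ τ (∨≡false⇒ʳ _ (∨≡false⇒ʳ (bulCtx Θ) •∉t)) (∨≡false⇒ˡ _ •∉t))
    [ρ]tm≡S⇓ (coh⊢ {Θ = Θ} _ _ τ) •∉t =
      cong (coh Θ _) (∘ρ≡ρ∘S⇓ τ (∨≡false⇒ʳ _ (∨≡false⇒ʳ (bulCtx Θ) •∉t)) (∨≡false⇒ˡ _ •∉t))

    ∘ρ≡ρ∘S⇓ : ∀ {Δ σ Γ} → Δ ⊢s σ ∶ Γ → bulSub σ ≡ false → bulCtx Γ ≡ false →
      σ ∘ ρ Δ ≡ ρ Γ ∘ SSub (⇓ctx Γ) (nfSub (⇓ctx Δ) (⇓sub σ))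
    ∘ρ≡ρ∘S⇓ (⟨⟩⊢ _) _ _ = refl
    ∘ρ≡ρ∘S⇓ {Δ} (ext⊢ {Γ = Γ} {σ = σ} {x = x} {A = ⋆} {t = t} σ⊢ (ext⊢ _ _ x∉Γ) ⊢t) •∉σx •∉Γx =
      begin
        (σ ∘ ρ Δ) , x ↦ t [ ρ Δ ]tm
      ≡⟨ cong₂ (_, x ↦_) (∘ρ≡ρ∘S⇓ σ⊢ (∨≡false⇒ˡ _ •∉σx) •∉Γ) ([ρ]-⋆ ⊢t) ⟩
        (ρ Γ ∘ SSub Γ̂ σ̂) , x ↦ v bul
      ≡⟨ cong ((ρ Γ ∘ SSub Γ̂ σ̂) , x ↦_)
              (sym (lookup-•-SSub Γ̂ σ̂ (∉dom⇒∉domₘ-nf⇓ σ⊢ (•∉dom Γ •∉Γ) (⇓ctx Δ)))) ⟩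
        ρ (Γ , x ∶ ⋆) ∘ SSub Γ̂ σ̂
      ≡⟨ cong (ρ (Γ , x ∶ ⋆) ∘_) (sym (SSub-𝟏-entry Γ̂ σ̂ _ (∉dom⇒∉domₘ-nf⇓ σ⊢ x∉Γ (⇓ctx Δ)))) ⟩
        ρ (Γ , x ∶ ⋆) ∘ SSub (⇓ctx (Γ , x ∶ ⋆)) (nfSub (⇓ctx Δ) (⇓sub (σ , x ↦ t)))
      ∎
      where
        Γ̂ = ⇓ctx Γ
        σ̂ = nfSub (⇓ctx Δ) (⇓sub σ)
        •∉Γ = ∨≡false⇒ˡ _ •∉Γx
    ∘ρ≡ρ∘S⇓ {Δ} (ext⊢ {Γ = Γ} {σ = σ} {x = x} {A = Hom A a b} {t = t} σ⊢ (ext⊢ _ _ x∉Γ) ⊢t) •∉σx •∉Γx =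
      begin
        (σ ∘ ρ Δ) , x ↦ t [ ρ Δ ]tm
      ≡⟨ cong₂ (_, x ↦_) (∘ρ≡ρ∘S⇓ σ⊢ (∨≡false⇒ˡ _ •∉σx) (∨≡false⇒ˡ _ •∉Γx))
                         ([ρ]tm≡S⇓ ⊢t (∨≡false⇒ʳ _ (∨≡false⇒ʳ (bulSub σ) •∉σx))) ⟩
        (ρ Γ ∘ Sσ̂) , x ↦ t̂
      ≡⟨ cong₂ (_, x ↦_) (sym (ρ∘-ext-fresh Γ x∉Γ x≢• Sσ̂ t̂)) (sym (lookup-here x Sσ̂ t̂)) ⟩
        ρ (Γ , x ∶ Hom A a b) ∘ (Sσ̂ , x ↦ t̂)
      ≡⟨ cong (ρ (Γ , x ∶ Hom A a b) ∘_)
              (sym (SSub-Hom-entry (⇓ctx Γ) _ _ _ σ̂ _ (∉dom⇒∉domₘ-nf⇓ σ⊢ x∉Γ (⇓ctx Δ)))) ⟩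
        ρ (Γ , x ∶ Hom A a b) ∘ SSub (⇓ctx (Γ , x ∶ Hom A a b)) (nfSub (⇓ctx Δ) (⇓sub (σ , x ↦ t)))
      ∎
      where
        σ̂ = nfSub (⇓ctx Δ) (⇓sub σ)
        Sσ̂ = SSub (⇓ctx Γ) σ̂
        t̂ = STm (nfTm (⇓ctx Δ) (⇓tm t))
        x≢• = ∨≡false⇒ˡ _ (∨≡false⇒ʳ (bulCtx Γ) •∉Γx)

  [ρ]ty≡S⇓ : ∀ {Δ} A → Δ ⊢ A → bulTy A ≡ false → A [ ρ Δ ]ty ≡ STy (nfTy (⇓ctx Δ) (⇓ty A))
  [ρ]ty≡S⇓ ⋆           _          _    = refl
  [ρ]ty≡S⇓ (Hom A t u) (Hom⊢ ⊢t ⊢u) •∉Atu =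
    cong-Hom ([ρ]ty≡S⇓ A (type-⊢ ⊢t) (∨≡false⇒ˡ _ •∉Atu))
             ([ρ]tm≡S⇓ ⊢t (∨≡false⇒ˡ _ •∉tu))
             ([ρ]tm≡S⇓ ⊢u (∨≡false⇒ʳ (bulTm t) •∉tu))
    where •∉tu = ∨≡false⇒ʳ (bulTy A) •∉Atu

mainTheorem12 : (R : SideConditions) → let open Rules R in
    ((Δ : Ctx) (A : Ty) → Δ ⊢ A → bulCtx Δ ≡ false → bulTy A ≡ false →
      A [ ρ Δ ]ty ≡ STy (nfTy (⇓ctx Δ) (⇓ty A)))
    × ((Δ : Ctx) (t : Tm) (A : Ty) → Δ ⊢ t ∶ A → bulCtx Δ ≡ false →
      bulTm t ≡ false → bulTy A ≡ false →
      t [ ρ Δ ]tm ≡ STm (nfTm (⇓ctx Δ) (⇓tm t)))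
    × ((Δ : Ctx) (σ : Sub) (Γ : Ctx) → Δ ⊢s σ ∶ Γ → bulCtx Δ ≡ false →
      bulSub σ ≡ false → bulCtx Γ ≡ false →
      σ ∘ ρ Δ ≡ ρ Γ ∘ SSub (⇓ctx Γ) (nfSub (⇓ctx Δ) (⇓sub σ)))
mainTheorem12 R =
  (λ Δ A ⊢A _ •∉A → [ρ]ty≡S⇓ R A ⊢A •∉A) ,
  (λ Δ t A ⊢t _ •∉t _ → [ρ]tm≡S⇓ R ⊢t •∉t) ,
  (λ Δ σ Γ ⊢σ _ •∉σ •∉Γ → ∘ρ≡ρ∘S⇓ R ⊢σ •∉σ •∉Γ)
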